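{- Let $\pi$ be a permutation of $\{1,\dots,n\}$, $G=G[\pi]$ and $k\ge 1$. Let $s_L$ be a scanline lying entirely to the left of all segments and $s_R$ a scanline lying entirely to the right of all segments of the matching diagram. Then $\mathrm{tcl}(G)\le k$ if and only if the scanline graph $W_k(G)$ contains a directed path from $s_L$ to $s_R$.
   Context: For a permutation $\pi$ of $\{1,\dots,n\}$, $G[\pi]$ has vertex set $\{1,\dots,n\}$ and edges $ij$ with $(i-j)(\pi^{ -1}_i-\pi^{ -1}_j)<0$. Matching diagram: on an upper horizontal line write $1,\dots,n$ left to right, on a lower line $\pi_1,\dots,\pi_n$ left to right, and join the two occurrences of each $i$ by a straight segment (the segment of vertex $i$). A scanline is a line segment with one endpoint on each horizontal line; it crosses a segment if they intersect. Two scanlines are equivalent if the set of segments whose top endpoint lies left of the scanline's top endpoint is the same for both, and likewise for bottom endpoints. A scanline is $k$-small if the vertices whose segments it crosses can be covered by at most $k$ cliques of $G$. For two scanlines $s_1,s_2$ whose intersection is empty or a common endpoint, the candidate component $\mathcal{C}(s_1,s_2)$ is the subgraph of $G$ induced by the vertices whose segments lie between the two scanlines or cross at least one of them. The scanline graph $W_k(G)$ is the directed graph whose vertices are representatives of the equivalence classes of $k$-small scanlines, with an arc from $s$ to $t$ if $s$ and $t$ meet exactly in a common endpoint, the other endpoint of $t$ lies to the right of the other endpoint of $s$, and the vertex set of $\mathcal{C}(s,t)$ can be covered by at most $k$ cliques of $G$. For $X\subseteq V(G)$, $\mathrm{vcc}(X)$ is the minimum number of cliques of $G$ whose union is $X$;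 $\mathrm{tcl}(G)$ is the minimum over tree decompositions $(T,\{X_t\})$ of $G$ of $\max_t \mathrm{vcc}(X_t)$ (tree decomposition: bags cover all vertices, every edge in some bag, bags containing any fixed vertex form a connected subtree). -}

module Defs where

open import Level using (0ℓ)
open import Data.Nat using (ℕ; zero; suc; _≤_; _<_)
open import Data.Fin using (Fin; toℕ; fromℕ) renaming (zero to fzero; suc to fsuc)
open import Data.Fin.Permutation using (Permutation′; _⟨$⟩ˡ_)
open import Data.Product using (Σ; ∃; ∃-syntax; _×_; _,_)
open import Data.Sum using (_⊎_)
open import Data.List using (List; length)
open import Data.List.Relation.Unary.All using (All)
open import Data.List.Relation.Unary.Any using (Any)
open import Relation.Nullary using (¬_)
open import Relation.Unary using (Pred; _∈_; _⊆_)
open import Relation.Binary.PropositionalEquality using (_≡_; _≢_)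
open import Relation.Binary.Construct.Closure.ReflexiveTransitive using (Star)

-- Vertices of G[π] are Fin n (0-indexed: vertex i stands for i+1).
-- Top endpoint of the segment of vertex i is at position toℕ i;
-- bottom endpoint is at position π⁻¹(i) = π ⟨$⟩ˡ i.

pos : ∀ {n} → Permutation′ n → Fin n → Fin n
pos π i = π ⟨$⟩ˡ i

Edge : ∀ {n} → Permutation′ n → Fin n → Fin n → Set
Edge π i j =
  (toℕ i < toℕ j × toℕ (pos π j) < toℕ (pos π i)) ⊎
  (toℕ j < toℕ i × toℕ (pos π i) < toℕ (pos π j))

IsClique : ∀ {n} → (Fin n → Fin n → Set) → Pred (Fin n) 0ℓ → Set
IsClique E C = ∀ i j → i ∈ C → j ∈ C → i ≢ j → E i j

CliqueCoverable : ∀ {n} → (Fin n → Fin n → Set) → ℕ → Pred (Fin n) 0ℓ → Set₁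
CliqueCoverable {n} E k X =
  Σ (List (Pred (Fin n) 0ℓ)) λ Cs →
    length Cs ≤ k ×
    All (λ C → IsClique E C × C ⊆ X) Cs ×
    (∀ x → x ∈ X → Any (λ C → x ∈ C) Cs)

-- Tree decompositions and tcl.
-- A (nonempty, finite) tree on nodes Fin (suc m) is given by a parent
-- array: node (fsuc j) is joined to node (parent j), whose index is ≤ j.

TreeAdj : ∀ {m} → (Fin m → Fin (suc m)) → Fin (suc m) → Fin (suc m) → Set
TreeAdj {m} parent x y =
  ∃[ j ] ((x ≡ fsuc j × y ≡ parent j) ⊎ (y ≡ fsuc j × x ≡ parent j))

data WalkIn {m} (parent : Fin m → Fin (suc m)) (S : Pred (Fin (suc m)) 0ℓ)
            : Fin (suc m) → Fin (suc m) → Set where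
  here : ∀ {x} → x ∈ S → WalkIn parent S x x
  step : ∀ {x y z} → x ∈ S → TreeAdj parent x y → WalkIn parent S y z →
         WalkIn parent S x z

record TreeDecomposition {n} (E : Fin n → Fin n → Set) : Set₁ where
  field
    m        : ℕ
    parent   : Fin m → Fin (suc m)
    parent≤  : ∀ j → toℕ (parent j) ≤ toℕ j
    bag      : Fin (suc m) → Pred (Fin n) 0ℓ
    covers   : ∀ v → ∃[ t ] (v ∈ bag t)
    edgeIn   : ∀ u v → E u v → ∃[ t ] (u ∈ bag t × v ∈ bag t)
    connected : ∀ v x y → v ∈ bag x → v ∈ bag y →
                WalkIn parent (λ t → v ∈ bag t) x y

TclAtMost : ∀ {n} → (Fin n → Fin n → Set) → ℕ → Set₁
TclAtMost E k =
  Σ (TreeDecomposition E) λ D →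
    ∀ t → CliqueCoverable E k (TreeDecomposition.bag D t)

-- A scanline class is determined by
-- (top, bot) ∈ {0..n}²: the segments whose top endpoint is left of the
-- scanline's top endpoint are exactly those with toℕ i < top, and the
-- segments whose bottom endpoint is left of its bottom endpoint are those
-- with toℕ (pos π i) < bot.

record Scanline (n : ℕ) : Set where
  constructor sl
  field
    top : Fin (suc n)
    bot : Fin (suc n)
open Scanline public

module _ {n} (π : Permutation′ n) where

  TopLeft : Scanline n → Fin n → Set
  TopLeft s i = toℕ i < toℕ (top s)

  BotLeft : Scanline n → Fin n → Set
  BotLeft s i = toℕ (pos π i) < toℕ (bot s)

  Crosses : Scanline n → Pred (Fin n) 0ℓ
  Crosses s i = (TopLeft s i × ¬ BotLeft s i) ⊎ (¬ TopLeft s i × BotLeft s i)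

  LeftOf : Scanline n → Pred (Fin n) 0ℓ
  LeftOf s i = TopLeft s i × BotLeft s i

  RightOf : Scanline n → Pred (Fin n) 0ℓ
  RightOf s i = ¬ TopLeft s i × ¬ BotLeft s i

  Small : ℕ → Scanline n → Set₁
  Small k s = CliqueCoverable (Edge π) k (Crosses s)

  -- candidate component C(s,t) for s weakly left of t:
  -- segments between the scanlines or crossing at least one of them
  Cand : Scanline n → Scanline n → Pred (Fin n) 0ℓ
  Cand s t i = Crosses s i ⊎ Crosses t i ⊎ (RightOf s i × LeftOf t i)

  ShareEndpointRight : Scanline n → Scanline n → Set
  ShareEndpointRight s t =
    (top s ≡ top t × toℕ (bot s) < toℕ (bot t)) ⊎
    (bot s ≡ bot t × toℕ (top s) < toℕ (top t))

  Arc : ℕ → Scanline n → Scanline n → Set₁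
  Arc k s t = Small k s × Small k t × ShareEndpointRight s t ×
              CliqueCoverable (Edge π) k (Cand s t)

  PathW : ℕ → Scanline n → Scanline n → Set₁
  PathW k s t = Small k s × Small k t × Star (Arc k) s t

sL : ∀ n → Scanline n
sL n = sl fzero fzero

sR : ∀ n → Scanline n
sR n = sl (fromℕ n) (fromℕ n)

-- Given a tree decomposition whose bags are k-coverable, the subtrees T_v = {t | v ∈ X_t}
-- meet for adjacent v, so their intersection graph H is a supergraph of G; comparing the
-- depths of the subtrees' roots shows that every square of H has a chord and (Helly) that
-- every clique of H lies inside one bag.  Sweep a scanline from s_L to s_R keeping the
-- segments it crosses an H-clique, moving whichever endpoint brings in a segment H-adjacent
-- to all of them: each candidate component is then the crossing set plus one segment, hence
-- inside a bag, and if neither endpoint can move, the two new segments together with two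
-- crossing segments witnessing the failures form a chordless square of H.
-- Conversely, the candidate components of consecutive scanlines on a path from s_L to s_R
-- are the bags of a path decomposition; the bags containing a vertex form an interval
-- because both endpoints of the scanlines only move rightwards.

module Submission where

open import Defs
open import Level using (0ℓ)
open import Data.Nat using (ℕ; zero; suc; pred; _≤_; _<_; z≤n; s≤s; s≤s⁻¹; _∸_; _+_)
open import Data.Nat.Properties
open import Data.Nat.Induction using (<-wellFounded)
open import Data.Fin.Induction
  using (<-weakInduction-startingFrom) renaming (<-wellFounded to <ᶠ-wellFounded)
open import Data.Fin using (Fin; toℕ; fromℕ; fromℕ<; inject₁) renaming (zero to fzero; suc to fsuc)
open import Data.Fin.Properties
  using (≤fromℕ; toℕ-injective; toℕ-fromℕ; toℕ-fromℕ<; toℕ<n; toℕ-inject₁; any?; all?; ¬∀⟶∃¬)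
  renaming (_≟_ to _≟ᶠ_)
open import Data.Fin.Permutation using (Permutation′; _⟨$⟩ˡ_; _⟨$⟩ʳ_; inverseˡ; inverseʳ)
open import Data.Product using (∃-syntax; _×_; _,_; proj₁; proj₂)
open import Data.Sum using (_⊎_; inj₁; inj₂; [_,_]′)
open import Data.Empty using (⊥; ⊥-elim)
open import Data.List using (List; []; _∷_; _++_; map; tabulate)
open import Data.List.Properties using (length-map)
import Data.List.Relation.Unary.All as All
open All using (All; []; _∷_)
import Data.List.Relation.Unary.All.Properties as Allₚ
import Data.List.Relation.Unary.Any as Any
open Any using (Any; here; there)
open import Data.List.Membership.Propositional using () renaming (_∈_ to _∈ₗ_)
open import Data.List.Membership.Propositional.Properties using (∈-++⁺ˡ; ∈-++⁺ʳ; ∈-tabulate⁺)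
import Data.List.Relation.Unary.Any.Properties as Anyₚ
open import Relation.Nullary using (¬_; Dec; yes; no)
open import Relation.Nullary.Decidable using (_×-dec_; _⊎-dec_; ¬?; _→-dec_; map′)
open import Relation.Unary using (Pred; _∈_; _⊆_; _∩_; Empty; Decidable)
open import Relation.Binary.PropositionalEquality
open import Relation.Binary.Core using (_⇒_)
open import Relation.Binary.Definitions using (Reflexive; Transitive)
open import Relation.Binary.Construct.Closure.ReflexiveTransitive using (Star; ε; _◅_)
import Relation.Binary.Construct.On as On
import Induction.WellFounded as WF
open import Function.Base using (_∘_)
open import Function.Bundles using (_⇔_; mk⇔)

module _ {n} {E : Fin n → Fin n → Set} {k : ℕ} where

  CliqueCoverable-⊆ : ∀ {X Y : Pred (Fin n) 0ℓ} →
                      Y ⊆ X → CliqueCoverable E k X → CliqueCoverable E k Y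
  CliqueCoverable-⊆ {Y = Y} Y⊆X (Cs , |Cs|≤k , cliques , covered) =
    map (_∩ Y) Cs ,
    subst (_≤ k) (sym (length-map (_∩ Y) Cs)) |Cs|≤k ,
    Allₚ.map⁺ (All.map (λ (clique , _) →
                         (λ i j i∈ j∈ → clique i j (proj₁ i∈) (proj₁ j∈)) , λ {_} → proj₂)
                       cliques) ,
    λ x x∈Y → Anyₚ.map⁺ (Any.map (_, x∈Y) (covered x (Y⊆X x∈Y)))

  Empty⇒CliqueCoverable : ∀ {X : Pred (Fin n) 0ℓ} → Empty X → CliqueCoverable E k X
  Empty⇒CliqueCoverable empty = [] , z≤n , [] , λ x x∈X → ⊥-elim (empty x x∈X)

Empty⊎argmax : ∀ {k} {X : Pred (Fin k) 0ℓ} → Decidable X → (f : Fin k → ℕ) →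
               Empty X ⊎ ∃[ v ] (X v × ∀ {a} → X a → f a ≤ f v)
Empty⊎argmax {zero} X? f = inj₁ λ ()
Empty⊎argmax {suc k} X? f with Empty⊎argmax (X? ∘ fsuc) (f ∘ fsuc) | X? fzero
... | inj₁ empty | no ¬x₀ = inj₁ λ { fzero → ¬x₀ ; (fsuc a) → empty a }
... | inj₁ empty | yes x₀ =
  inj₂ (fzero , x₀ , λ { {fzero} _ → ≤-refl ; {fsuc a} xa → ⊥-elim (empty a xa) })
... | inj₂ (v , xv , max) | no ¬x₀ =
  inj₂ (fsuc v , xv , λ { {fzero} x₀ → ⊥-elim (¬x₀ x₀) ; {fsuc a} xa → max xa })
... | inj₂ (v , xv , max) | yes x₀ with ≤-total (f fzero) (f (fsuc v))
...   | inj₁ f₀≤ = inj₂ (fsuc v , xv , λ { {fzero} _ → f₀≤ ; {fsuc a} xa → max xa })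
...   | inj₂ ≤f₀ = inj₂ (fzero , x₀ , λ { {fzero} _ → ≤-refl ; {fsuc a} xa → ≤-trans (max xa) ≤f₀ })

drop-point : {Q : Pred ℕ 0ℓ} → Decidable Q → Q 0 → ∀ N → ¬ Q N →
             ∃[ j ] (j < N × Q j × ¬ Q (suc j))
drop-point Q? q₀ zero ¬q = ⊥-elim (¬q q₀)
drop-point Q? q₀ (suc N) ¬q with Q? N
... | yes qN = N , ≤-refl , qN , ¬q
... | no ¬qN with drop-point Q? q₀ N ¬qN
...   | j , j<N , qj , ¬qsj = j , m<n⇒m<1+n j<N , qj , ¬qsj

module _ {A : Set} {ℓ} {R : A → A → Set ℓ} where

  Star-length : ∀ {a b} → Star R a b → ℕ
  Star-length ε       = 0
  Star-length (_ ◅ w) = suc (Star-length w)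

  Star-at : ∀ {a b} → Star R a b → ℕ → A
  Star-at {a} _       zero    = a
  Star-at {a} ε       (suc _) = a
  Star-at     (_ ◅ w) (suc j) = Star-at w j

  Star-at-length : ∀ {a b} (w : Star R a b) → Star-at w (Star-length w) ≡ b
  Star-at-length ε       = refl
  Star-at-length (_ ◅ w) = Star-at-length w

  Star-at-step : ∀ {a b} (w : Star R a b) {j} → j < Star-length w →
                 R (Star-at w j) (Star-at w (suc j))
  Star-at-step (r ◅ _) {zero}  _         = r
  Star-at-step (_ ◅ w) {suc j} (s≤s j<ℓ) = Star-at-step w j<ℓ

  Star-at-mono : ∀ {ℓ′} {P : A → A → Set ℓ′} → Reflexive P → Transitive P → R ⇒ P →
                 ∀ {a b} (w : Star R a b) {i j} → i ≤ j → P (Star-at w i) (Star-at w j)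
  Star-at-mono {P = P} refl′ trans′ R⇒P = mono
    where
      mono : ∀ {a b} (w : Star R a b) {i j} → i ≤ j → P (Star-at w i) (Star-at w j)
      mono ε       {zero}  {zero}  _         = refl′
      mono ε       {zero}  {suc _} _         = refl′
      mono ε       {suc _} {suc _} _         = refl′
      mono (r ◅ w) {zero}  {zero}  _         = refl′
      mono (r ◅ w) {zero}  {suc j} _         = trans′ (R⇒P r) (mono w {0} {j} z≤n)
      mono (r ◅ w) {suc i} {suc j} (s≤s i≤j) = mono w i≤j

<toℕ-fromℕ : ∀ {n} (i : Fin n) → toℕ i < toℕ (fromℕ n)
<toℕ-fromℕ {n} i = subst (toℕ i <_) (sym (toℕ-fromℕ n)) (toℕ<n i)

module _ {n} (π : Permutation′ n) where

  Edge? : ∀ u v → Dec (Edge π u v)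
  Edge? u v = ((toℕ u <? toℕ v) ×-dec (toℕ (pos π v) <? toℕ (pos π u)))
       ⊎-dec ((toℕ v <? toℕ u) ×-dec (toℕ (pos π u) <? toℕ (pos π v)))

  Edge-sym : ∀ {u v} → Edge π u v → Edge π v u
  Edge-sym (inj₁ e) = inj₂ e
  Edge-sym (inj₂ e) = inj₁ e

  pos-injective : ∀ {u v} → toℕ (pos π u) ≡ toℕ (pos π v) → u ≡ v
  pos-injective {u} {v} eq = begin
    u                       ≡⟨ inverseʳ π ⟨
    π ⟨$⟩ʳ (π ⟨$⟩ˡ u)       ≡⟨ cong (π ⟨$⟩ʳ_) (toℕ-injective eq) ⟩
    π ⟨$⟩ʳ (π ⟨$⟩ˡ v)       ≡⟨ inverseʳ π ⟩
    v                       ∎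
    where open ≡-Reasoning

  toℕ-pos-⟨$⟩ʳ : ∀ {p} (p<n : p < n) → toℕ (pos π (π ⟨$⟩ʳ fromℕ< p<n)) ≡ p
  toℕ-pos-⟨$⟩ʳ p<n = trans (cong toℕ (inverseˡ π)) (toℕ-fromℕ< p<n)

  TopLeft? : ∀ s i → Dec (TopLeft π s i)
  TopLeft? s i = toℕ i <? toℕ (top s)

  BotLeft? : ∀ s i → Dec (BotLeft π s i)
  BotLeft? s i = toℕ (pos π i) <? toℕ (bot s)

  Crosses? : ∀ s i → Dec (Crosses π s i)
  Crosses? s i = (TopLeft? s i ×-dec ¬? (BotLeft? s i)) ⊎-dec (¬? (TopLeft? s i) ×-dec BotLeft? s i)

  RightOf? : ∀ s i → Dec (RightOf π s i)
  RightOf? s i = ¬? (TopLeft? s i) ×-dec ¬? (BotLeft? s i)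

  _≼_ : Scanline n → Scanline n → Set
  s ≼ t = toℕ (top s) ≤ toℕ (top t) × toℕ (bot s) ≤ toℕ (bot t)

  ≼-refl : ∀ {s} → s ≼ s
  ≼-refl = ≤-refl , ≤-refl

  ≼-trans : ∀ {s t u} → s ≼ t → t ≼ u → s ≼ u
  ≼-trans (top≤ , bot≤) (top≤′ , bot≤′) = ≤-trans top≤ top≤′ , ≤-trans bot≤ bot≤′

  ShareEndpointRight⇒≼ : ∀ {s t} → ShareEndpointRight π s t → s ≼ t
  ShareEndpointRight⇒≼ (inj₁ (top≡ , bot<)) = ≤-reflexive (cong toℕ top≡) , <⇒≤ bot<
  ShareEndpointRight⇒≼ (inj₂ (bot≡ , top<)) = <⇒≤ top< , ≤-reflexive (cong toℕ bot≡)

  LeftOf-mono : ∀ {s t} → s ≼ t → LeftOf π s ⊆ LeftOf π t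
  LeftOf-mono (top≤ , bot≤) (tl , bl) = <-≤-trans tl top≤ , <-≤-trans bl bot≤

  RightOf-anti : ∀ {s t} → s ≼ t → RightOf π t ⊆ RightOf π s
  RightOf-anti (top≤ , bot≤) (¬tl , ¬bl) =
    (λ tl → ¬tl (<-≤-trans tl top≤)) , (λ bl → ¬bl (<-≤-trans bl bot≤))

  Crosses⇒¬LeftOf : ∀ {s i} → Crosses π s i → ¬ LeftOf π s i
  Crosses⇒¬LeftOf (inj₁ (_ , ¬bl)) (_ , bl) = ¬bl bl
  Crosses⇒¬LeftOf (inj₂ (¬tl , _)) (tl , _) = ¬tl tl

  Crosses⇒¬RightOf : ∀ {s i} → Crosses π s i → ¬ RightOf π s i
  Crosses⇒¬RightOf (inj₁ (tl , _)) (¬tl , _) = ¬tl tl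
  Crosses⇒¬RightOf (inj₂ (_ , bl)) (_ , ¬bl) = ¬bl bl

  RightOf⇒¬LeftOf : ∀ {s i} → RightOf π s i → ¬ LeftOf π s i
  RightOf⇒¬LeftOf (¬tl , _) (tl , _) = ¬tl tl

  Cand⇒between : ∀ {s t i} → s ≼ t → Cand π s t i → ¬ LeftOf π s i × ¬ RightOf π t i
  Cand⇒between s≼t (inj₁ cross) =
    Crosses⇒¬LeftOf cross , λ right → Crosses⇒¬RightOf cross (RightOf-anti s≼t right)
  Cand⇒between s≼t (inj₂ (inj₁ cross)) =
    (λ left → Crosses⇒¬LeftOf cross (LeftOf-mono s≼t left)) , Crosses⇒¬RightOf cross
  Cand⇒between s≼t (inj₂ (inj₂ (right , left))) =
    RightOf⇒¬LeftOf right , λ right′ → RightOf⇒¬LeftOf right′ left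

  between⇒Cand : ∀ {s t i} → ¬ LeftOf π s i → ¬ RightOf π t i → Cand π s t i
  between⇒Cand {s} {t} {i} ¬left ¬right with TopLeft? s i | BotLeft? s i
  ... | yes tl | yes bl = ⊥-elim (¬left (tl , bl))
  ... | yes tl | no ¬bl = inj₁ (inj₁ (tl , ¬bl))
  ... | no ¬tl | yes bl = inj₁ (inj₂ (¬tl , bl))
  ... | no ¬tl | no ¬bl with TopLeft? t i | BotLeft? t i
  ...   | yes tl | yes bl = inj₂ (inj₂ ((¬tl , ¬bl) , (tl , bl)))
  ...   | yes tl | no ¬bl′ = inj₂ (inj₁ (inj₁ (tl , ¬bl′)))
  ...   | no ¬tl′ | yes bl = inj₂ (inj₁ (inj₂ (¬tl′ , bl)))
  ...   | no ¬tl′ | no ¬bl′ = ⊥-elim (¬right (¬tl′ , ¬bl′))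

  LeftOf-RightOf-¬Edge : ∀ {s u v} → LeftOf π s u → RightOf π s v → ¬ Edge π u v
  LeftOf-RightOf-¬Edge (_ , bl) (_ , ¬bl) (inj₁ (_ , v<u)) = ¬bl (<-trans v<u bl)
  LeftOf-RightOf-¬Edge (tl , _) (¬tl , _) (inj₂ (v<u , _)) = ¬tl (<-trans v<u tl)

  sL-uncrossed : ∀ {i} → ¬ Crosses π (sL n) i
  sL-uncrossed (inj₁ (() , _))
  sL-uncrossed (inj₂ (_ , ()))

  sR-uncrossed : ∀ {i} → ¬ Crosses π (sR n) i
  sR-uncrossed {i} (inj₁ (_ , ¬bl)) = ¬bl (<toℕ-fromℕ (pos π i))
  sR-uncrossed {i} (inj₂ (¬tl , _)) = ¬tl (<toℕ-fromℕ i)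

  module _ {s : Scanline n} {u w : Fin n}
           (u-at-top : toℕ u ≡ toℕ (top s)) (w-at-bot : toℕ (pos π w) ≡ toℕ (bot s))
           (¬cross-u : ¬ Crosses π s u) (¬cross-w : ¬ Crosses π s w) where

    bot≤pos-u : toℕ (bot s) ≤ toℕ (pos π u)
    bot≤pos-u = ≮⇒≥ λ bl → ¬cross-u (inj₂ (<-irrefl u-at-top , bl))

    top≤w : toℕ (top s) ≤ toℕ w
    top≤w = ≮⇒≥ λ tl → ¬cross-w (inj₁ (tl , <-irrefl w-at-bot))

    crossing⇒adjacent : ∀ {x} → Crosses π s x → Edge π u x ⊎ Edge π x w
    crossing⇒adjacent {x} cross@(inj₁ (tl , ¬bl)) =
      inj₂ (inj₁ (<-≤-trans tl top≤w , pos-w<pos-x))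
      where
        pos-w<pos-x : toℕ (pos π w) < toℕ (pos π x)
        pos-w<pos-x = ≤∧≢⇒< (subst (_≤ toℕ (pos π x)) (sym w-at-bot) (≮⇒≥ ¬bl))
                            (λ eq → ¬cross-w (subst (Crosses π s) (pos-injective (sym eq)) cross))
    crossing⇒adjacent {x} cross@(inj₂ (¬tl , bl)) =
      inj₁ (inj₁ (u<x , <-≤-trans bl bot≤pos-u))
      where
        u<x : toℕ u < toℕ x
        u<x = ≤∧≢⇒< (subst (_≤ toℕ x) (sym u-at-top) (≮⇒≥ ¬tl))
                    (λ eq → ¬cross-u (subst (Crosses π s) (toℕ-injective (sym eq)) cross))

    top-bot-adjacent : u ≡ w ⊎ Edge π u w
    top-bot-adjacent with u ≟ᶠ w
    ... | yes u≡w = inj₁ u≡w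
    ... | no u≢w = inj₂ (inj₁
      ( ≤∧≢⇒< (subst (_≤ toℕ w) (sym u-at-top) top≤w) (λ eq → u≢w (toℕ-injective eq))
      , ≤∧≢⇒< (subst (_≤ toℕ (pos π u)) (sym w-at-bot) bot≤pos-u)
              (λ eq → u≢w (pos-injective (sym eq)))))

-- From a tree decomposition to a path in the scanline graph

-- Realised by the intersection graph of the subtrees of a tree decomposition; chords of
-- squares are all the greedy sweep needs, not full chordality.
record CoverableSupergraph {n} (E : Fin n → Fin n → Set) (k : ℕ) : Set₁ where
  field
    _∼_           : Fin n → Fin n → Set
    _∼?_          : ∀ u v → Dec (u ∼ v)
    ∼-refl        : ∀ u → u ∼ u
    ∼-sym         : ∀ {u v} → u ∼ v → v ∼ u
    Edge⇒∼        : ∀ {u v} → E u v → u ∼ v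
    square-chord  : ∀ {a b c d} → a ∼ b → b ∼ c → c ∼ d → d ∼ a → a ∼ c ⊎ b ∼ d
    clique-coverable : (X : Pred (Fin n) 0ℓ) → Decidable X → (∀ {a b} → X a → X b → a ∼ b) →
                       CliqueCoverable E k X

module RootedTree {m : ℕ} (parent : Fin m → Fin (suc m))
                  (parent≤ : ∀ j → toℕ (parent j) ≤ toℕ j) where

  data Ancestor (c : Fin (suc m)) : Fin (suc m) → Set where
    self  : Ancestor c c
    child : ∀ j → Ancestor c (parent j) → Ancestor c (fsuc j)

  parent<child : ∀ j → toℕ (parent j) < toℕ (fsuc j)
  parent<child j = s≤s (parent≤ j)

  Ancestor⇒≤ : ∀ {c z} → Ancestor c z → toℕ c ≤ toℕ z
  Ancestor⇒≤ self          = ≤-refl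
  Ancestor⇒≤ (child j anc) = ≤-trans (Ancestor⇒≤ anc) (<⇒≤ (parent<child j))

  Ancestor-trans : ∀ {a b c} → Ancestor a b → Ancestor b c → Ancestor a c
  Ancestor-trans a-b self          = a-b
  Ancestor-trans a-b (child j b-c) = child j (Ancestor-trans a-b b-c)

  Ancestor-antisym : ∀ {a b} → Ancestor a b → Ancestor b a → a ≡ b
  Ancestor-antisym a-b b-a = toℕ-injective (≤-antisym (Ancestor⇒≤ a-b) (Ancestor⇒≤ b-a))

  Ancestor-chain : ∀ {c₁ c₂ x} → Ancestor c₁ x → Ancestor c₂ x → toℕ c₂ ≤ toℕ c₁ → Ancestor c₂ c₁
  Ancestor-chain self c₂-x _ = c₂-x
  Ancestor-chain (child j c₁-x) self c₂≤c₁ =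
    ⊥-elim (<⇒≱ (≤-<-trans (Ancestor⇒≤ c₁-x) (parent<child j)) c₂≤c₁)
  Ancestor-chain (child j c₁-x) (child .j c₂-x) c₂≤c₁ = Ancestor-chain c₁-x c₂-x c₂≤c₁

  Ancestor? : ∀ c z → Dec (Ancestor c z)
  Ancestor? c = WF.All.wfRec <ᶠ-wellFounded _ (λ z → Dec (Ancestor c z)) decide
    where
      decide : ∀ z → (∀ {y} → toℕ y < toℕ z → Dec (Ancestor c y)) → Dec (Ancestor c z)
      decide z rec with c ≟ᶠ z
      decide z rec | yes refl = yes self
      decide fzero rec | no c≢0 = no λ { self → c≢0 refl }
      decide (fsuc j) rec | no c≢z =
        map′ (child j) (λ { self → ⊥-elim (c≢z refl) ; (child _ anc) → anc }) (rec (parent<child j))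

  edge-exit : ∀ {z p q} → TreeAdj parent p q → Ancestor z p → ¬ Ancestor z q →
              ∃[ j ] (z ≡ fsuc j × p ≡ z × q ≡ parent j)
  edge-exit (j , inj₁ (refl , refl)) self          _      = j , refl , refl , refl
  edge-exit (j , inj₁ (refl , refl)) (child .j anc) ¬anc = ⊥-elim (¬anc anc)
  edge-exit (j , inj₂ (refl , refl)) anc           ¬anc  = ⊥-elim (¬anc (child j anc))

  walk-exit : ∀ {S : Pred (Fin (suc m)) 0ℓ} {x y z} → WalkIn parent S x y →
              Ancestor z x → ¬ Ancestor z y → ∃[ j ] (z ≡ fsuc j × S z × S (parent j))
  walk-exit (here _) anc ¬anc = ⊥-elim (¬anc anc)
  walk-exit {z = z} (step {y = y} sx adj walk) anc ¬anc with Ancestor? z y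
  ... | yes anc′ = walk-exit walk anc′ ¬anc
  ... | no ¬anc′ with edge-exit adj anc ¬anc′
  ...   | j , z≡ , refl , refl = j , z≡ , sx , walk-start walk
    where
      walk-start : ∀ {S : Pred (Fin (suc m)) 0ℓ} {a b} → WalkIn parent S a b → S a
      walk-start (here sa)     = sa
      walk-start (step sa _ _) = sa

  module Connected (S : Pred (Fin (suc m)) 0ℓ)
                   (connected : ∀ x y → S x → S y → WalkIn parent S x y) where

    common-ancestor₂ : ∀ {a b} → S a → S b → ∃[ c ] (S c × Ancestor c a × Ancestor c b)
    common-ancestor₂ {a} {b} = WF.All.wfRec <ᶠ-wellFounded _ Lift climb a
      where
        Lift : Pred (Fin (suc m)) 0ℓ
        Lift a = S a → S b → ∃[ c ] (S c × Ancestor c a × Ancestor c b)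

        climb : ∀ a → (∀ {a′} → toℕ a′ < toℕ a → Lift a′) → Lift a
        climb a rec sa sb with Ancestor? a b
        ... | yes a-b = a , sa , self , a-b
        ... | no ¬a-b with walk-exit (connected a b sa sb) self ¬a-b
        ...   | j , refl , _ , s-parent with rec (parent<child j) s-parent sb
        ...     | c , sc , c-parent , c-b = c , sc , child j c-parent , c-b

    common-ancestor : ∀ {a zs} → All S (a ∷ zs) → ∃[ c ] (S c × All (Ancestor c) (a ∷ zs))
    common-ancestor {a} {[]} (sa ∷ []) = a , sa , self ∷ []
    common-ancestor {a} {z ∷ zs} (sa ∷ sz ∷ s-zs) with common-ancestor (sa ∷ s-zs)
    ... | c , sc , c-a ∷ c-zs with common-ancestor₂ sc sz
    ...   | c′ , sc′ , c′-c , c′-z =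
      c′ , sc′ , Ancestor-trans c′-c c-a ∷ c′-z ∷ All.map (Ancestor-trans c′-c) c-zs

    convex : ∀ {c z z′} → S c → S z′ → Ancestor c z → Ancestor z z′ → S z
    convex {c} {z} {z′} sc sz′ c-z z-z′ with Ancestor? z c
    ... | yes z-c = subst S (Ancestor-antisym c-z z-c) sc
    ... | no ¬z-c = proj₁ (proj₂ (proj₂ (walk-exit (connected z′ c sz′ sc) z-z′ ¬z-c)))

module RootedSubtrees {n N : ℕ} (Model : Fin n → Fin N → Set) (Model? : ∀ v z → Dec (Model v z))
         (root : Fin n → Fin N) (root∈ : ∀ v → Model v (root v))
         (deeper-root∈ : ∀ {a b z} → Model a z → Model b z → toℕ (root b) ≤ toℕ (root a) →
                         Model b (root a)) where

  depth : Fin n → ℕ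
  depth v = toℕ (root v)

  Meets : Fin n → Fin n → Set
  Meets a b = ∃[ z ] (Model a z × Model b z)

  Meets? : ∀ a b → Dec (Meets a b)
  Meets? a b = any? λ z → Model? a z ×-dec Model? b z

  Meets-refl : ∀ a → Meets a a
  Meets-refl a = root a , root∈ a , root∈ a

  Meets-sym : ∀ {a b} → Meets a b → Meets b a
  Meets-sym (z , a∋z , b∋z) = z , b∋z , a∋z

  Meets-through : ∀ {a b c} → Meets a c → Meets b c → depth a ≤ depth c → depth b ≤ depth c →
                  Meets a b
  Meets-through (_ , a∋x , c∋x) (_ , b∋y , c∋y) a≤c b≤c =
    root _ , deeper-root∈ c∋x a∋x a≤c , deeper-root∈ c∋y b∋y b≤c

  square-chord : ∀ {a b c d} → Meets a b → Meets b c → Meets c d → Meets d a → Meets a c ⊎ Meets b d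
  square-chord {a} {b} {c} {d} ab bc cd da
    with ≤-total (depth a) (depth c) | ≤-total (depth b) (depth d)
  ... | inj₁ a≤c | inj₁ b≤d with ≤-total (depth c) (depth d)
  ...   | inj₁ c≤d = inj₁ (Meets-through (Meets-sym da) cd (≤-trans a≤c c≤d) c≤d)
  ...   | inj₂ d≤c = inj₂ (Meets-through bc (Meets-sym cd) (≤-trans b≤d d≤c) d≤c)
  square-chord {a} {b} {c} {d} ab bc cd da | inj₁ a≤c | inj₂ d≤b with ≤-total (depth c) (depth b)
  ...   | inj₁ c≤b = inj₁ (Meets-through ab (Meets-sym bc) (≤-trans a≤c c≤b) c≤b)
  ...   | inj₂ b≤c = inj₂ (Meets-through bc (Meets-sym cd) b≤c (≤-trans d≤b b≤c))
  square-chord {a} {b} {c} {d} ab bc cd da | inj₂ c≤a | inj₁ b≤d with ≤-total (depth a) (depth d)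
  ...   | inj₁ a≤d = inj₁ (Meets-through (Meets-sym da) cd a≤d (≤-trans c≤a a≤d))
  ...   | inj₂ d≤a = inj₂ (Meets-through (Meets-sym ab) da (≤-trans b≤d d≤a) d≤a)
  square-chord {a} {b} {c} {d} ab bc cd da | inj₂ c≤a | inj₂ d≤b with ≤-total (depth a) (depth b)
  ...   | inj₁ a≤b = inj₁ (Meets-through ab (Meets-sym bc) a≤b (≤-trans c≤a a≤b))
  ...   | inj₂ b≤a = inj₂ (Meets-through (Meets-sym ab) da b≤a (≤-trans d≤b b≤a))

  helly : {X : Pred (Fin n) 0ℓ} → Decidable X → (∀ {a b} → X a → X b → Meets a b) →
          Empty X ⊎ ∃[ z ] (∀ {a} → X a → Model a z)
  helly X? pairwise with Empty⊎argmax X? depth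
  ... | inj₁ empty = inj₁ empty
  ... | inj₂ (v , xv , deepest) =
    inj₂ (root v , λ xa → contains-root (pairwise xv xa) (deepest xa))
    where
      contains-root : ∀ {a} → Meets v a → depth a ≤ depth v → Model a (root v)
      contains-root (_ , v∋z , a∋z) = deeper-root∈ v∋z a∋z

module DecompositionSubtrees {n} {E : Fin n → Fin n → Set} (E? : ∀ u v → Dec (E u v))
                             (D : TreeDecomposition E) where
  open TreeDecomposition D
  open RootedTree parent parent≤

  Node : Set
  Node = Fin (suc m)

  T[_] : Fin n → Pred Node 0ℓ
  T[ v ] t = v ∈ bag t

  edgeNode : Fin n → Fin n → Node → Node
  edgeNode u v fallback with E? u v
  ... | yes e = proj₁ (edgeIn u v e)
  ... | no _  = fallback

  edgeNode-∈ˡ : ∀ {u v t} → T[ u ] t → T[ u ] (edgeNode u v t)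
  edgeNode-∈ˡ {u} {v} u∈ with E? u v
  ... | yes e = proj₁ (proj₂ (edgeIn u v e))
  ... | no _  = u∈

  edgeNode-∈ʳ : ∀ {u v t} → T[ v ] t → T[ v ] (edgeNode u v t)
  edgeNode-∈ʳ {u} {v} v∈ with E? u v
  ... | yes e = proj₂ (proj₂ (edgeIn u v e))
  ... | no _  = v∈

  edgeNode-irrelevant : ∀ {u v} → E u v → ∀ t t′ → edgeNode u v t ≡ edgeNode u v t′
  edgeNode-irrelevant {u} {v} e t t′ with E? u v
  ... | yes _  = refl
  ... | no ¬e = ⊥-elim (¬e e)

  cover : Fin n → Node
  cover v = proj₁ (covers v)

  anchors : Fin n → List Node
  anchors v = cover v ∷ tabulate (λ u → edgeNode u v (cover v))
                     ++ tabulate (λ u → edgeNode v u (cover v))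

  anchors⊆T : ∀ v → All T[ v ] (anchors v)
  anchors⊆T v = cover∈ ∷ Allₚ.++⁺ (Allₚ.tabulate⁺ λ u → edgeNode-∈ʳ {u} cover∈)
                                 (Allₚ.tabulate⁺ λ u → edgeNode-∈ˡ {v = u} cover∈)
    where cover∈ = proj₂ (covers v)

  rooting : ∀ v → ∃[ c ] (T[ v ] c × All (Ancestor c) (anchors v))
  rooting v = Connected.common-ancestor T[ v ] (connected v) (anchors⊆T v)

  root : Fin n → Node
  root v = proj₁ (rooting v)

  root∈T : ∀ v → T[ v ] (root v)
  root∈T v = proj₁ (proj₂ (rooting v))

  root-above-anchors : ∀ v → All (Ancestor (root v)) (anchors v)
  root-above-anchors v = proj₂ (proj₂ (rooting v))

  -- Bags are arbitrary predicates, so T[ v ] is not decidable; Model v is the decidable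
  -- subtree of T[ v ] spanned by a root and the anchors of v (a bag containing v and, for
  -- each edge at v, a bag containing that edge).
  Model : Fin n → Node → Set
  Model v z = Ancestor (root v) z × Any (Ancestor z) (anchors v)

  Model? : ∀ v z → Dec (Model v z)
  Model? v z = Ancestor? (root v) z ×-dec Any.any? (Ancestor? z) (anchors v)

  Model⊆T : ∀ {v z} → Model v z → T[ v ] z
  Model⊆T {v} (root-z , below-anchor) with All.lookupAny (anchors⊆T v) below-anchor
  ... | anchor∈T , z-anchor =
    Connected.convex T[ v ] (connected v) (root∈T v) anchor∈T root-z z-anchor

  anchor⇒Model : ∀ {v z} → z ∈ₗ anchors v → Model v z
  anchor⇒Model {v} z∈ = All.lookup (root-above-anchors v) z∈ , Any.map (λ { refl → self }) z∈

  root∈ : ∀ v → Model v (root v)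
  root∈ v = self , here (All.head (root-above-anchors v))

  deeper-root∈ : ∀ {a b z} → Model a z → Model b z → toℕ (root b) ≤ toℕ (root a) → Model b (root a)
  deeper-root∈ (root-a-z , _) (root-b-z , b-below) b≤a =
    Ancestor-chain root-a-z root-b-z b≤a , Any.map (Ancestor-trans root-a-z) b-below

  open RootedSubtrees Model Model? root root∈ deeper-root∈ public

  E⇒Meets : ∀ {u v} → E u v → Meets u v
  E⇒Meets {u} {v} e =
    edgeNode u v (cover v) ,
    subst (Model u) (edgeNode-irrelevant e (cover u) (cover v))
      (anchor⇒Model (there (∈-++⁺ʳ (tabulate _) (∈-tabulate⁺ v)))) ,
    anchor⇒Model (there (∈-++⁺ˡ (∈-tabulate⁺ u)))

TclAtMost⇒CoverableSupergraph : ∀ {n} {E : Fin n → Fin n → Set} {k} → (∀ u v → Dec (E u v)) →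
                                 TclAtMost E k → CoverableSupergraph E k
TclAtMost⇒CoverableSupergraph {E = E} {k} E? (D , bags-coverable) = record
  { _∼_ = Meets
  ; _∼?_ = Meets?
  ; ∼-refl = Meets-refl
  ; ∼-sym = Meets-sym
  ; Edge⇒∼ = E⇒Meets
  ; square-chord = square-chord
  ; clique-coverable = clique-coverable
  }
  where
    open DecompositionSubtrees E? D

    clique-coverable : ∀ X → Decidable X → (∀ {a b} → X a → X b → Meets a b) → CliqueCoverable E k X
    clique-coverable X X? pairwise with helly X? pairwise
    ... | inj₁ empty = Empty⇒CliqueCoverable empty
    ... | inj₂ (z , X⊆Model) = CliqueCoverable-⊆ (λ x∈X → Model⊆T (X⊆Model x∈X)) (bags-coverable z)

module Greedy {n} (π : Permutation′ n) {k} (H : CoverableSupergraph (Edge π) k) where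
  open CoverableSupergraph H

  CrossingClique : Scanline n → Set
  CrossingClique s = ∀ {x y} → Crosses π s x → Crosses π s y → x ∼ y

  Compatible : Scanline n → Fin n → Set
  Compatible s v = ∀ {x} → Crosses π s x → x ∼ v

  Compatible? : ∀ s v → Dec (Compatible s v)
  Compatible? s v = map′ (λ f {x} → f x) (λ f x → f) (all? λ x → Crosses? π s x →-dec x ∼? v)

  incompatible-witness : ∀ {s v} → ¬ Compatible s v → ∃[ x ] (Crosses π s x × ¬ x ∼ v)
  incompatible-witness {s} {v} ¬compat
    with ¬∀⟶∃¬ n _ (λ x → Crosses? π s x →-dec x ∼? v) (λ f → ¬compat (λ {x} → f x))
  ... | x , ¬[cross→∼] with Crosses? π s x
  ...   | yes cross = x , cross , λ x∼v → ¬[cross→∼] (λ _ → x∼v)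
  ...   | no ¬cross = ⊥-elim (¬[cross→∼] (λ cross → ⊥-elim (¬cross cross)))

  arc-from : ∀ {s t} v → ShareEndpointRight π s t →
             (∀ {x} → Cand π s t x → Crosses π s x ⊎ x ≡ v) →
             CrossingClique s → Compatible s v → Arc π k s t × CrossingClique t
  arc-from {s} {t} v share Cand⊆ clique compat =
    (coverable (Cand⊆ ∘ inj₁) , coverable (Cand⊆ ∘ inj₂ ∘ inj₁) , share , coverable Cand⊆) ,
    λ cx cy → pairwise (Cand⊆ (inj₂ (inj₁ cx))) (Cand⊆ (inj₂ (inj₁ cy)))
    where
      X : Pred (Fin n) 0ℓ
      X x = Crosses π s x ⊎ x ≡ v

      pairwise : ∀ {a b} → X a → X b → a ∼ b
      pairwise (inj₁ ca) (inj₁ cb)   = clique ca cb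
      pairwise (inj₁ ca) (inj₂ refl) = compat ca
      pairwise (inj₂ refl) (inj₁ cb) = ∼-sym (compat cb)
      pairwise (inj₂ refl) (inj₂ refl) = ∼-refl _

      coverable : ∀ {Y} → Y ⊆ X → CliqueCoverable (Edge π) k Y
      coverable Y⊆X = CliqueCoverable-⊆ Y⊆X
        (clique-coverable X (λ x → Crosses? π s x ⊎-dec x ≟ᶠ v) pairwise)

  -- Every crossing segment is adjacent to u or to w in G, so x ∼ w and u ∼ y, and the
  -- square x w u y of H would have no chord.
  no-dead-end : ∀ {s u w} → CrossingClique s →
                toℕ u ≡ toℕ (top s) → toℕ (pos π w) ≡ toℕ (bot s) →
                ¬ Compatible s u → ¬ Compatible s w → ⊥
  no-dead-end {s} {u} {w} clique u-at-top w-at-bot ¬compat-u ¬compat-w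
    with incompatible-witness ¬compat-u | incompatible-witness ¬compat-w
  ... | x , cross-x , x≁u | y , cross-y , y≁w =
    [ x≁u , (λ w∼y → y≁w (∼-sym w∼y)) ]′ (square-chord x∼w w∼u u∼y (clique cross-y cross-x))
    where
      uncrossed : ∀ {v} → ¬ Compatible s v → ¬ Crosses π s v
      uncrossed ¬compat cross-v = ¬compat (λ cross → clique cross cross-v)

      adjacent : ∀ {z} → Crosses π s z → Edge π u z ⊎ Edge π z w
      adjacent = crossing⇒adjacent π u-at-top w-at-bot (uncrossed ¬compat-u) (uncrossed ¬compat-w)

      x∼w : x ∼ w
      x∼w = [ (λ e → ⊥-elim (x≁u (∼-sym (Edge⇒∼ e)))) , Edge⇒∼ ]′ (adjacent cross-x)

      u∼y : u ∼ y
      u∼y = [ Edge⇒∼ , (λ e → ⊥-elim (y≁w (Edge⇒∼ e))) ]′ (adjacent cross-y)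

      w∼u : w ∼ u
      w∼u = [ (λ { refl → ∼-refl u }) , (λ e → ∼-sym (Edge⇒∼ e)) ]′
              (top-bot-adjacent π u-at-top w-at-bot (uncrossed ¬compat-u) (uncrossed ¬compat-w))

  μ : Scanline n → ℕ
  μ s = (n ∸ toℕ (top s)) + (n ∸ toℕ (bot s))

  Progress : Scanline n → Set₁
  Progress s = ∃[ t ] (Arc π k s t × CrossingClique t × μ t < μ s)

  module _ {s : Scanline n} (clique : CrossingClique s) where

    top-progress : (t<n : toℕ (top s) < n) → Compatible s (fromℕ< t<n) → Progress s
    top-progress t<n compat = t , proj₁ move , proj₂ move , μt<μs
      where
        t : Scanline n
        t = sl (fromℕ< (s≤s t<n)) (bot s)

        top-t : toℕ (top t) ≡ suc (toℕ (top s))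
        top-t = toℕ-fromℕ< (s≤s t<n)

        Cand⊆ : ∀ {x} → Cand π s t x → Crosses π s x ⊎ x ≡ fromℕ< t<n
        Cand⊆ (inj₁ cross) = inj₁ cross
        Cand⊆ {x} (inj₂ (inj₁ (inj₁ (tl , ¬bl))))
          with m≤n⇒m<n∨m≡n (s≤s⁻¹ (subst (toℕ x <_) top-t tl))
        ... | inj₁ x<top = inj₁ (inj₁ (x<top , ¬bl))
        ... | inj₂ x≡top = inj₂ (toℕ-injective (trans x≡top (sym (toℕ-fromℕ< t<n))))
        Cand⊆ {x} (inj₂ (inj₁ (inj₂ (¬tl , bl)))) =
          inj₁ (inj₂ ((λ tl → ¬tl (subst (toℕ x <_) (sym top-t) (m<n⇒m<1+n tl))) , bl))
        Cand⊆ (inj₂ (inj₂ ((_ , ¬bl) , (_ , bl)))) = ⊥-elim (¬bl bl)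

        move : Arc π k s t × CrossingClique t
        move = arc-from (fromℕ< t<n) (inj₂ (refl , subst (toℕ (top s) <_) (sym top-t) ≤-refl))
                        Cand⊆ clique compat

        μt<μs : μ t < μ s
        μt<μs = subst (λ a → (n ∸ a) + (n ∸ toℕ (bot s)) < μ s) (sym top-t)
                      (+-monoˡ-< (n ∸ toℕ (bot s)) (∸-monoʳ-< ≤-refl t<n))

    bot-progress : (b<n : toℕ (bot s) < n) → Compatible s (π ⟨$⟩ʳ fromℕ< b<n) → Progress s
    bot-progress b<n compat = t , proj₁ move , proj₂ move , μt<μs
      where
        t : Scanline n
        t = sl (top s) (fromℕ< (s≤s b<n))

        bot-t : toℕ (bot t) ≡ suc (toℕ (bot s))
        bot-t = toℕ-fromℕ< (s≤s b<n)

        w : Fin n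
        w = π ⟨$⟩ʳ fromℕ< b<n

        w-at-bot : toℕ (pos π w) ≡ toℕ (bot s)
        w-at-bot = toℕ-pos-⟨$⟩ʳ π b<n

        Cand⊆ : ∀ {x} → Cand π s t x → Crosses π s x ⊎ x ≡ w
        Cand⊆ (inj₁ cross) = inj₁ cross
        Cand⊆ {x} (inj₂ (inj₁ (inj₂ (¬tl , bl))))
          with m≤n⇒m<n∨m≡n (s≤s⁻¹ (subst (toℕ (pos π x) <_) bot-t bl))
        ... | inj₁ x<bot = inj₁ (inj₂ (¬tl , x<bot))
        ... | inj₂ x≡bot = inj₂ (pos-injective π (trans x≡bot (sym w-at-bot)))
        Cand⊆ {x} (inj₂ (inj₁ (inj₁ (tl , ¬bl)))) =
          inj₁ (inj₁ (tl , λ bl → ¬bl (subst (toℕ (pos π x) <_) (sym bot-t) (m<n⇒m<1+n bl))))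
        Cand⊆ (inj₂ (inj₂ ((¬tl , _) , (tl , _)))) = ⊥-elim (¬tl tl)

        move : Arc π k s t × CrossingClique t
        move = arc-from w (inj₁ (refl , subst (toℕ (bot s) <_) (sym bot-t) ≤-refl))
                        Cand⊆ clique compat

        μt<μs : μ t < μ s
        μt<μs = subst (λ a → (n ∸ toℕ (top s)) + (n ∸ a) < μ s) (sym bot-t)
                      (+-monoʳ-< (n ∸ toℕ (top s)) (∸-monoʳ-< ≤-refl b<n))

  advance : ∀ s → CrossingClique s → s ≡ sR n ⊎ Progress s
  advance s clique with toℕ (top s) <? n | toℕ (bot s) <? n
  ... | no ¬t<n | no ¬b<n = inj₁ (cong₂ sl (at-end (top s) ¬t<n) (at-end (bot s) ¬b<n))
    where
      at-end : (i : Fin (suc n)) → ¬ toℕ i < n → i ≡ fromℕ n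
      at-end i ¬i<n = toℕ-injective (≤-antisym (≤fromℕ i)
                        (subst (_≤ toℕ i) (sym (toℕ-fromℕ n)) (≮⇒≥ ¬i<n)))
  ... | yes t<n | no ¬b<n = inj₂ (top-progress clique t<n (λ cross → clique cross u-crosses))
    where
      u-crosses : Crosses π s (fromℕ< t<n)
      u-crosses = inj₂ (<-irrefl (toℕ-fromℕ< t<n) , <-≤-trans (toℕ<n _) (≮⇒≥ ¬b<n))
  ... | no ¬t<n | yes b<n = inj₂ (bot-progress clique b<n (λ cross → clique cross w-crosses))
    where
      w-crosses : Crosses π s (π ⟨$⟩ʳ fromℕ< b<n)
      w-crosses = inj₁ (<-≤-trans (toℕ<n _) (≮⇒≥ ¬t<n) ,
                        <-irrefl (toℕ-pos-⟨$⟩ʳ π b<n))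
  ... | yes t<n | yes b<n with Compatible? s (fromℕ< t<n) | Compatible? s (π ⟨$⟩ʳ fromℕ< b<n)
  ...   | yes compat | _ = inj₂ (top-progress clique t<n compat)
  ...   | no _ | yes compat = inj₂ (bot-progress clique b<n compat)
  ...   | no ¬compat-u | no ¬compat-w =
    ⊥-elim (no-dead-end clique (toℕ-fromℕ< t<n) (toℕ-pos-⟨$⟩ʳ π b<n) ¬compat-u ¬compat-w)

  path-to-sR : ∀ s → CrossingClique s → Star (Arc π k) s (sR n)
  path-to-sR = WF.All.wfRec (On.wellFounded μ <-wellFounded) _
                 (λ s → CrossingClique s → Star (Arc π k) s (sR n)) extend
    where
      extend : ∀ s → (∀ {t} → μ t < μ s → CrossingClique t → Star (Arc π k) t (sR n)) →
               CrossingClique s → Star (Arc π k) s (sR n)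
      extend s rec clique with advance s clique
      ... | inj₁ refl = ε
      ... | inj₂ (t , arc , clique′ , μt<μs) = arc ◅ rec μt<μs clique′

  greedy-path : PathW π k (sL n) (sR n)
  greedy-path = Empty⇒CliqueCoverable (λ _ → sL-uncrossed π) ,
                Empty⇒CliqueCoverable (λ _ → sR-uncrossed π) ,
                path-to-sR (sL n) (λ cross → ⊥-elim (sL-uncrossed π cross))

-- From a path in the scanline graph to a path decomposition

module _ {m : ℕ} {parent : Fin m → Fin (suc m)} {S : Pred (Fin (suc m)) 0ℓ} where

  TreeAdj-sym : ∀ {x y} → TreeAdj parent x y → TreeAdj parent y x
  TreeAdj-sym (j , inj₁ edge) = j , inj₂ edge
  TreeAdj-sym (j , inj₂ edge) = j , inj₁ edge

  WalkIn-snoc : ∀ {x y z} → WalkIn parent S x y → S z → TreeAdj parent y z → WalkIn parent S x z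
  WalkIn-snoc (here sx)          sz adj = step sx adj (here sz)
  WalkIn-snoc (step sx adj walk) sz adj′ = step sx adj (WalkIn-snoc walk sz adj′)

  WalkIn-reverse : ∀ {x y} → WalkIn parent S x y → WalkIn parent S y x
  WalkIn-reverse (here sx)          = here sx
  WalkIn-reverse (step sx adj walk) = WalkIn-snoc (WalkIn-reverse walk) sx (TreeAdj-sym adj)

module _ {m : ℕ} {S : Pred (Fin (suc m)) 0ℓ} where

  descending-walk : ∀ {x y} → toℕ x ≤ toℕ y →
                    (∀ {z} → toℕ x ≤ toℕ z → toℕ z ≤ toℕ y → S z) → WalkIn inject₁ S y x
  descending-walk {x} {y} x≤y S-between =
    <-weakInduction-startingFrom P (λ _ x≤y → here (S-between ≤-refl x≤y)) extend x≤y x≤y ≤-refl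
    where
      P : Pred (Fin (suc m)) 0ℓ
      P z = toℕ x ≤ toℕ z → toℕ z ≤ toℕ y → WalkIn inject₁ S z x

      extend : ∀ j → P (inject₁ j) → P (fsuc j)
      extend j walk x≤sj sj≤y with m≤n⇒m<n∨m≡n x≤sj
      ... | inj₂ x≡sj = subst (WalkIn inject₁ S (fsuc j)) (toℕ-injective (sym x≡sj))
                              (here (S-between x≤sj sj≤y))
      ... | inj₁ x<sj = step (S-between x≤sj sj≤y) (j , inj₁ (refl , refl))
                             (walk (subst (toℕ x ≤_) (sym (toℕ-inject₁ j)) (s≤s⁻¹ x<sj))
                                   (subst (_≤ toℕ y) (sym (toℕ-inject₁ j)) (≤-trans (n≤1+n _) sj≤y)))

  interval-walk : ∀ {x y} →
                  (∀ {z} → (toℕ x ≤ toℕ z × toℕ z ≤ toℕ y) ⊎ (toℕ y ≤ toℕ z × toℕ z ≤ toℕ x) → S z) →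
                  WalkIn inject₁ S x y
  interval-walk {x} {y} S-between with ≤-total (toℕ x) (toℕ y)
  ... | inj₁ x≤y = WalkIn-reverse (descending-walk x≤y λ x≤z z≤y → S-between (inj₁ (x≤z , z≤y)))
  ... | inj₂ y≤x = descending-walk y≤x λ y≤z z≤x → S-between (inj₂ (y≤z , z≤x))

module PathDecomposition {n} (π : Permutation′ n) {k} (path : Star (Arc π k) (sL n) (sR n)) where

  ℓ : ℕ
  ℓ = Star-length path

  s : ℕ → Scanline n
  s = Star-at path

  s-mono : ∀ {i j} → i ≤ j → _≼_ π (s i) (s j)
  s-mono = Star-at-mono (≼-refl π) (≼-trans π)
                        (λ arc → ShareEndpointRight⇒≼ π (proj₁ (proj₂ (proj₂ arc)))) path

  -- Node 0 gets Cand (s 0) (s 0) = Cand sL sL, which is empty.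
  Bag : ℕ → Pred (Fin n) 0ℓ
  Bag i = Cand π (s (pred i)) (s i)

  Between : ℕ → Pred (Fin n) 0ℓ
  Between i v = ¬ LeftOf π (s (pred i)) v × ¬ RightOf π (s i) v

  Bag⇒Between : ∀ i {v} → Bag i v → Between i v
  Bag⇒Between i = Cand⇒between π (s-mono (pred[n]≤n {i}))

  Between⇒Bag : ∀ i {v} → Between i v → Bag i v
  Between⇒Bag i (¬left , ¬right) = between⇒Cand π ¬left ¬right

  Between-convex : ∀ {i l v} j → Between i v → Between l v → i ≤ j → j ≤ l → Between j v
  Between-convex j (_ , ¬right) (¬left , _) i≤j j≤l =
    (λ left → ¬left (LeftOf-mono π (s-mono (pred-mono-≤ j≤l)) left)) ,
    (λ right → ¬right (RightOf-anti π (s-mono i≤j) right))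

  leaves-right : ∀ v → ∃[ j ] (j < ℓ × RightOf π (s j) v × ¬ RightOf π (s (suc j)) v)
  leaves-right v = drop-point (λ j → RightOf? π (s j) v) ((λ ()) , (λ ())) ℓ
                     (λ right → ¬right-of-sR (subst (λ t → RightOf π t v) (Star-at-length path) right))
    where
      ¬right-of-sR : ¬ RightOf π (sR n) v
      ¬right-of-sR (¬tl , _) = ¬tl (<toℕ-fromℕ v)

  index : Fin n → ℕ
  index v = proj₁ (leaves-right v)

  index<ℓ : ∀ v → index v < ℓ
  index<ℓ v = proj₁ (proj₂ (leaves-right v))

  right-at-index : ∀ v → RightOf π (s (index v)) v
  right-at-index v = proj₁ (proj₂ (proj₂ (leaves-right v)))

  ¬right-after-index : ∀ v → ¬ RightOf π (s (suc (index v))) v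
  ¬right-after-index v = proj₂ (proj₂ (proj₂ (leaves-right v)))

  home : Fin n → Fin (suc ℓ)
  home v = fromℕ< (s≤s (index<ℓ v))

  toℕ-home : ∀ v → toℕ (home v) ≡ suc (index v)
  toℕ-home v = toℕ-fromℕ< (s≤s (index<ℓ v))

  in-home-bag : ∀ {v u} → ¬ LeftOf π (s (index v)) u → ¬ RightOf π (s (suc (index v))) u →
                Bag (toℕ (home v)) u
  in-home-bag {v} {u} ¬left ¬right =
    subst (λ i → Bag i u) (sym (toℕ-home v)) (between⇒Cand π ¬left ¬right)

  home∋self : ∀ v → Bag (toℕ (home v)) v
  home∋self v = in-home-bag (RightOf⇒¬LeftOf π (right-at-index v)) (¬right-after-index v)

  home∋neighbour : ∀ {u v} → Edge π u v → index u ≤ index v → Bag (toℕ (home v)) u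
  home∋neighbour {u} {v} e iu≤iv =
    in-home-bag (λ left-u → LeftOf-RightOf-¬Edge π left-u (right-at-index v) e)
                (λ right-u → ¬right-after-index u (RightOf-anti π (s-mono (s≤s iu≤iv)) right-u))

  decomposition : TreeDecomposition (Edge π)
  decomposition = record
    { m = ℓ
    ; parent = inject₁
    ; parent≤ = λ j → ≤-reflexive (toℕ-inject₁ j)
    ; bag = Bag ∘ toℕ
    ; covers = λ v → home v , home∋self v
    ; edgeIn = edgeIn
    ; connected = λ v x y x∋v y∋v → interval-walk λ
        { {z} (inj₁ (x≤z , z≤y)) → Between⇒Bag (toℕ z)
            (Between-convex (toℕ z) (Bag⇒Between (toℕ x) x∋v) (Bag⇒Between (toℕ y) y∋v) x≤z z≤y)
        ; {z} (inj₂ (y≤z , z≤x)) → Between⇒Bag (toℕ z)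
            (Between-convex (toℕ z) (Bag⇒Between (toℕ y) y∋v) (Bag⇒Between (toℕ x) x∋v) y≤z z≤x) }
    }
    where
      edgeIn : ∀ u v → Edge π u v → ∃[ t ] (Bag (toℕ t) u × Bag (toℕ t) v)
      edgeIn u v e with ≤-total (index u) (index v)
      ... | inj₁ iu≤iv = home v , home∋neighbour e iu≤iv , home∋self v
      ... | inj₂ iv≤iu = home u , home∋self u , home∋neighbour (Edge-sym π e) iv≤iu

  Bag-coverable : ∀ i → i ≤ ℓ → CliqueCoverable (Edge π) k (Bag i)
  Bag-coverable zero    _   = Empty⇒CliqueCoverable λ
    { v (inj₁ cross) → sL-uncrossed π cross
    ; v (inj₂ (inj₁ cross)) → sL-uncrossed π cross
    ; v (inj₂ (inj₂ ((_ , _) , (() , _)))) }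
  Bag-coverable (suc i) i<ℓ = proj₂ (proj₂ (proj₂ (Star-at-step path i<ℓ)))

  tcl≤k : TclAtMost (Edge π) k
  tcl≤k = decomposition , λ t → Bag-coverable (toℕ t) (s≤s⁻¹ (toℕ<n t))

lemma17 : (n : ℕ) (π : Permutation′ n) (k : ℕ) → 1 ≤ k →
          (TclAtMost (Edge π) k ⇔ PathW π k (sL n) (sR n))
lemma17 n π k _ = mk⇔
  (λ tcl≤k → Greedy.greedy-path π (TclAtMost⇒CoverableSupergraph (Edge? π) tcl≤k))
  (λ (_ , _ , path) → PathDecomposition.tcl≤k π path)
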